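{- Let $G$ be a connected degree-regular graph with $N$ vertices, diameter $d$, and numbers $k_0=1,k_1,\ldots,k_d$ (where $k_i$ is the number of vertices at distance $i$ from any given vertex). Let $\mu=\dim(G)$ be its metric dimension. Then $$N\le |\mathcal{S}(\mu;k_0,k_1,\ldots,k_d)|,$$ where $\mathcal{S}(\mu;k_0,k_1,\ldots,k_d)$ is the set of sequences of length $\mu$ with entries in $\{0,1,\ldots,d\}$ in which each value $i$ appears at most $k_i$ times.
   Context: A connected graph $G$ with diameter $d$ is degree-regular if for each $i=0,1,\ldots,d$ the number $k_i(u)$ of vertices at distance exactly $i$ from $u$ does not depend on the vertex $u$; this common value is denoted $k_i$. A vertex subset $C=\{z_1,\ldots,z_c\}$ is a resolving set if every vertex $u$ is uniquely determined by $(\operatorname{dist}_G(u,z_1),\ldots,\operatorname{dist}_G(u,z_c))$; the metric dimension $\dim(G)$ is the minimum cardinality of a resolving set. -}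

module Defs where

open import Data.Nat using (ℕ; zero; suc; _+_; _≤_; _≤ᵇ_; _≡ᵇ_)
open import Data.Bool using (Bool; true; false; _∧_; _∨_; if_then_else_; not)
open import Data.Fin using (Fin; toℕ; _≟_)
open import Data.Fin.Subset using (Subset; _∈_; ∣_∣)
open import Data.Vec using (Vec; []; _∷_)
open import Data.Bool.ListAction using (any; all)
open import Data.List using (List; []; _∷_; allFin; length; filter; map; concatMap)
open import Data.Product using (Σ; ∃; ∃-syntax; _×_)
open import Relation.Nullary.Decidable using (⌊_⌋)
open import Relation.Binary.PropositionalEquality using (_≡_)
open import Data.Bool using (T)

record Graph (N : ℕ) : Set where
  field
    adj    : Fin N → Fin N → Bool
    sym    : ∀ u v → adj u v ≡ adj v u
    irrefl : ∀ u → adj u u ≡ false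
open Graph public

module _ {N : ℕ} (G : Graph N) where

  reach : ℕ → Fin N → Fin N → Bool
  reach zero    u v = ⌊ u ≟ v ⌋
  reach (suc n) u v = reach n u v ∨ any (λ w → reach n u w ∧ adj G w v) (allFin N)

-- least p b = the least n < b with p n = true, or b if there is none
least : (ℕ → Bool) → ℕ → ℕ
least p zero    = 0
least p (suc b) = if p 0 then 0 else suc (least (λ n → p (suc n)) b)

module _ {N : ℕ} (G : Graph N) where

  -- Graph distance: the length of a shortest walk from u to v
  -- (for a connected graph on N vertices every distance is < N).
  dist : Fin N → Fin N → ℕ
  dist u v = least (λ n → reach G n u v) N

  Connected : Set
  Connected = ∀ u v → ∃[ n ] T (reach G n u v)

  HasDiameter : ℕ → Set
  HasDiameter d = (∀ u v → dist u v ≤ d) × (∃[ u ] ∃[ v ] dist u v ≡ d)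

  countV : (Fin N → Bool) → ℕ
  countV p = length (filter (λ v → T? (p v)) (allFin N))
    where
    open import Data.Bool.Properties using () renaming (T? to T?)

  kAt : Fin N → ℕ → ℕ
  kAt u i = countV (λ v → dist u v ≡ᵇ i)

  DegreeRegular : (d : ℕ) → (Fin (suc d) → ℕ) → Set
  DegreeRegular d k = ∀ u (i : Fin (suc d)) → kAt u (toℕ i) ≡ k i

  Resolving : Subset N → Set
  Resolving C = ∀ u v → (∀ z → z ∈ C → dist u z ≡ dist v z) → u ≡ v

  IsMetricDimension : ℕ → Set
  IsMetricDimension μ =
    (∃[ C ] (Resolving C × ∣ C ∣ ≡ μ)) × (∀ C → Resolving C → μ ≤ ∣ C ∣)

allVecs : {A : Set} → List A → (m : ℕ) → List (Vec A m)
allVecs xs zero    = [] ∷ []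
allVecs xs (suc m) = concatMap (λ x → map (x ∷_) (allVecs xs m)) xs

occ : {d m : ℕ} → Fin (suc d) → Vec (Fin (suc d)) m → ℕ
occ i []       = 0
occ i (x ∷ s)  = (if ⌊ i ≟ x ⌋ then 1 else 0) + occ i s

inS : {d m : ℕ} → (Fin (suc d) → ℕ) → Vec (Fin (suc d)) m → Bool
inS {d} k s = all (λ i → occ i s ≤ᵇ k i) (allFin (suc d))

cardS : (μ d : ℕ) → (Fin (suc d) → ℕ) → ℕ
cardS μ d k = length (filter (λ s → T? (inS k s)) (allVecs (allFin (suc d)) μ))
  where
  open import Data.Bool.Properties using () renaming (T? to T?)

-- Fix a resolving set C of size μ. Listing the distances from a vertex u to the
-- elements of C gives a sequence with entries in {0,…,d}; the value i can occur
-- in it at most k_i(u) = k_i times, because its occurrences come from distinct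
-- vertices of C at distance i from u. So u ↦ (dist u z)_{z ∈ C} maps the N
-- vertices into S(μ; k_0,…,k_d), injectively because C is resolving.
module Submission where

open import Defs
open import Data.Nat using (ℕ; suc; _≤_)
open import Data.Fin using (Fin)

open import Data.Nat using (zero; s≤s; z≤n; _≡ᵇ_)
open import Data.Nat.Properties using (≤-trans; ≤-refl; ≤-reflexive; ≡⇒≡ᵇ; ≤⇒≤ᵇ; n≤1+n)
open import Data.Fin using (toℕ; fromℕ<; _≟_) renaming (zero to fzero; suc to fsuc)
open import Data.Fin.Properties using (toℕ-fromℕ<; injective⇒≤)
open import Data.Fin.Subset using (Subset; ∣_∣)
import Data.Fin.Subset as Subset
open import Data.Vec using (Vec; []; _∷_; head; tail; here; there)
open import Data.Bool using (Bool; true; false; T)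
open import Data.Bool.Properties using (T?)
open import Data.List using (List; _∷_; length; filter; tabulate; allFin; map; lookup)
import Data.List.Relation.Unary.All as All
open import Data.List.Relation.Unary.All.Properties using (all⁻)
open import Data.List.Relation.Unary.Any using (index) renaming (here to hereₗ)
open import Data.List.Relation.Unary.Any.Properties using (lookup-index)
open import Data.List.Membership.Propositional using (_∈_)
open import Data.List.Membership.Propositional.Properties
  using (∈-filter⁺; ∈-concat⁺′; ∈-map⁺; ∈-allFin)
open import Data.List.Properties using (filter-accept; filter-reject)
open import Data.Product using (_,_)
open import Function using (_∘_; id)
open import Function.Definitions using (Injective)
open import Relation.Nullary using (yes; no)
open import Relation.Binary.PropositionalEquality using (_≡_; refl; trans; cong)
import Relation.Binary.PropositionalEquality as ≡

restrict : ∀ {n} {A : Set} (C : Subset n) → (Fin n → A) → Vec A ∣ C ∣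
restrict []          g = []
restrict (true  ∷ C) g = g fzero ∷ restrict C (g ∘ fsuc)
restrict (false ∷ C) g = restrict C (g ∘ fsuc)

restrict-≡⇒agree : ∀ {n} {A : Set} (C : Subset n) (g h : Fin n → A) →
  restrict C g ≡ restrict C h → ∀ z → z Subset.∈ C → g z ≡ h z
restrict-≡⇒agree (true  ∷ C) g h eq fzero     here      = cong head eq
restrict-≡⇒agree (true  ∷ C) g h eq (fsuc z) (there z∈C) =
  restrict-≡⇒agree C (g ∘ fsuc) (h ∘ fsuc) (cong tail eq) z z∈C
restrict-≡⇒agree (false ∷ C) g h eq (fsuc z) (there z∈C) =
  restrict-≡⇒agree C (g ∘ fsuc) (h ∘ fsuc) eq z z∈C

length-filter-∷-≤ : ∀ {X : Set} (p : X → Bool) x xs →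
  length (filter (T? ∘ p) xs) ≤ length (filter (T? ∘ p) (x ∷ xs))
length-filter-∷-≤ p x xs with T? (p x)
... | yes px rewrite filter-accept (T? ∘ p) {xs = xs} px = n≤1+n _
... | no ¬px rewrite filter-reject (T? ∘ p) {xs = xs} ¬px = ≤-refl

-- Occurrences of i in the restriction come from distinct indices v with h v ≡ i,
-- each of which passes the filter. Stated over tabulate f rather than allFin n
-- so that the induction on C goes through.
occ-restrict-≤ : ∀ {d n} {X : Set} (i : Fin (suc d)) (C : Subset n)
  (h : Fin n → Fin (suc d)) (f : Fin n → X) (p : X → Bool) →
  (∀ v → i ≡ h v → T (p (f v))) →
  occ i (restrict C h) ≤ length (filter (T? ∘ p) (tabulate f))
occ-restrict-≤ i [] h f p h⇒p = z≤n
occ-restrict-≤ i (false ∷ C) h f p h⇒p =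
  ≤-trans (occ-restrict-≤ i C (h ∘ fsuc) (f ∘ fsuc) p (h⇒p ∘ fsuc))
          (length-filter-∷-≤ p (f fzero) _)
occ-restrict-≤ i (true ∷ C) h f p h⇒p with i ≟ h fzero
... | yes i≡h₀ rewrite filter-accept (T? ∘ p) {xs = tabulate (f ∘ fsuc)} (h⇒p fzero i≡h₀) =
  s≤s (occ-restrict-≤ i C (h ∘ fsuc) (f ∘ fsuc) p (h⇒p ∘ fsuc))
... | no _ =
  ≤-trans (occ-restrict-≤ i C (h ∘ fsuc) (f ∘ fsuc) p (h⇒p ∘ fsuc))
          (length-filter-∷-≤ p (f fzero) _)

allVecs-complete : ∀ {A : Set} (xs : List A) → (∀ x → x ∈ xs) →
  ∀ m (v : Vec A m) → v ∈ allVecs xs m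
allVecs-complete xs xs-full zero    []      = hereₗ refl
allVecs-complete xs xs-full (suc m) (x ∷ v) =
  ∈-concat⁺′ (∈-map⁺ (x ∷_) (allVecs-complete xs xs-full m v))
             (∈-map⁺ (λ y → map (y ∷_) (allVecs xs m)) (xs-full x))

injection-into-list⇒≤ : ∀ {n} {A : Set} {xs : List A} (f : Fin n → A) →
  Injective _≡_ _≡_ f → (∀ u → f u ∈ xs) → n ≤ length xs
injection-into-list⇒≤ {xs = xs} f f-inj f∈xs =
  injective⇒≤ {f = index ∘ f∈xs} λ {u} {v} eq → f-inj
    (trans (lookup-index (f∈xs u))
      (trans (cong (lookup xs) eq) (≡.sym (lookup-index (f∈xs v)))))

inS-intro : ∀ {d m} (k : Fin (suc d) → ℕ) (s : Vec (Fin (suc d)) m) →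
  (∀ i → occ i s ≤ k i) → T (inS k s)
inS-intro {d} k s occ≤k = all⁻ _ {allFin (suc d)} (All.tabulate λ {i} _ → ≤⇒≤ᵇ (occ≤k i))

inS⇒∈S : ∀ {d m} (k : Fin (suc d) → ℕ) (s : Vec (Fin (suc d)) m) → T (inS k s) →
  s ∈ filter (T? ∘ inS k) (allVecs (allFin (suc d)) m)
inS⇒∈S {d} {m} k s s∈S =
  ∈-filter⁺ (T? ∘ inS k) (allVecs-complete (allFin (suc d)) ∈-allFin m s) s∈S

module DistanceVectors {N : ℕ} (G : Graph N) {d : ℕ} (diam : ∀ u v → dist G u v ≤ d) where

  distFin : Fin N → Fin N → Fin (suc d)
  distFin u z = fromℕ< (s≤s (diam u z))

  toℕ-distFin : ∀ u z → toℕ (distFin u z) ≡ dist G u z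
  toℕ-distFin u z = toℕ-fromℕ< (s≤s (diam u z))

  distVec : (C : Subset N) → Fin N → Vec (Fin (suc d)) ∣ C ∣
  distVec C u = restrict C (distFin u)

  distVec-injective : ∀ {C} → Resolving G C → Injective _≡_ _≡_ (distVec C)
  distVec-injective {C} resolving {u} {v} eq = resolving u v λ z z∈C → begin
    dist G u z           ≡⟨ toℕ-distFin u z ⟨
    toℕ (distFin u z)    ≡⟨ cong toℕ (restrict-≡⇒agree C (distFin u) (distFin v) eq z z∈C) ⟩
    toℕ (distFin v z)    ≡⟨ toℕ-distFin v z ⟩
    dist G v z           ∎
    where open ≡.≡-Reasoning

  occ-distVec-≤-kAt : ∀ C u i → occ i (distVec C u) ≤ kAt G u (toℕ i)
  occ-distVec-≤-kAt C u i = occ-restrict-≤ i C (distFin u) id (λ v → dist G u v ≡ᵇ toℕ i)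
    λ v i≡distFin → ≡⇒≡ᵇ _ _ (trans (≡.sym (toℕ-distFin u v)) (cong toℕ (≡.sym i≡distFin)))

mainTheorem3 : (N : ℕ) (G : Graph N) (d : ℕ) (k : Fin (suc d) → ℕ) (μ : ℕ) →
    Connected G → HasDiameter G d → DegreeRegular G d k →
    IsMetricDimension G μ →
    N ≤ cardS μ d k
mainTheorem3 N G d k μ _ (diam , _) regular ((C , resolving , refl) , _) =
  injection-into-list⇒≤ (distVec C) (distVec-injective resolving) λ u →
    inS⇒∈S k (distVec C u) (inS-intro k (distVec C u) λ i →
      ≤-trans (occ-distVec-≤-kAt C u i) (≤-reflexive (regular u i)))
  where open DistanceVectors G diam
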